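{- Let $n\ge1$, $k\ge1$. The edge labeling of the Hasse diagram of $\mathcal{L}_n^{(k)}$ which assigns to each cover $\pi\lessdot\pi'$ its label $(\alpha,\beta)_l$ (and the label $(1,n)_k$ to each cover $\pi\lessdot\hat1$), with labels totally ordered as in the context, is an $EL$-labeling of $\mathcal{L}_n^{(k)}$.
   Context: Write $[n]=\{1,\dots,n\}$. A weighted partition of $[n]$ with $k$ layers is a $k$-tuple $\pi=(\pi^{(1)},\dots,\pi^{(k)})$ of set partitions of $[n]$ such that $\pi^{(l+1)}$ refines $\pi^{(l)}$ for $1\le l<k$ (equivalently, in the paper's notation, layer $l\ge2$ records the blocks of $\pi^{(l)}$ of size $\ge2$). $\mathcal{P}_n^{(k)}$ is the set of these; rank $\rho(\pi)=n-(\text{number of blocks of }\pi^{(1)})$. Labeled covers: for $\pi\in\mathcal{P}_n^{(k)}$, $1\le\alpha<\beta\le n$, $l\in[k]$, the label $(\alpha,\beta)_l$ is admissible at $\pi$ if $\alpha,\beta$ lie in different blocks $A\ni\alpha$, $B\ni\beta$ of $\pi^{(1)}$, $\beta=\min B$, and $\alpha$ is the smallest element of its block in $\pi^{(l)}$; then $\pi'$ is obtained by replacing, for each $m=1,\dots,l$, the two blocks of $\pi^{(m)}$ containing $\alpha$ and $\beta$ by their union, with $\pi'^{(m)}=\pi^{(m)}$ for $m>l$, and we declare $\pi\lessdot\pi'$ with label $(\alpha,\beta)_l$. The order on $\mathcal{P}_n^{(k)}$ is the reflexive-transitive closure. $\mathcal{L}_n^{(k)}=\mathcal{P}_n^{(k)}\cup\{\hat1\}$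 with additionally $\pi\lessdot\hat1$ labeled $(1,n)_k$ for every $\pi$ of rank $n-1$; $\rho(\hat 1)=n$, and $\hat0$ is the all-singletons element. Total order on labels: $(\alpha_1,\beta_1)_l<(\alpha_2,\beta_2)_{l'}$ iff $l>l'$, or $l=l'$ and $\alpha_1<\alpha_2$, or $l=l'$, $\alpha_1=\alpha_2$ and $\beta_1<\beta_2$. A chain $x_0\lessdot x_1\lessdot\dots\lessdot x_m$ is rising if its labels are weakly increasing. An edge labeling $\lambda$ of a graded poset is an $EL$-labeling if (i) every interval $[x,y]$ contains exactly one rising maximal chain $x=x_0\lessdot x_1\lessdot\dots\lessdot x_m=y$, and (ii) for this chain, whenever $x\lessdot z\le y$ with $z\ne x_1$, one has $\lambda(x,x_1)<\lambda(x,z)$. -}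

module Defs where

open import Data.Nat as ℕ using (ℕ; zero; suc; _∸_)
open import Data.Fin as Fin using (Fin; zero; suc; toℕ; fromℕ; _≟_)
open import Data.Fin.Properties using () renaming (_≤?_ to _≤ᶠ?_)
open import Data.Vec using (Vec; lookup; tabulate)
open import Data.List using (List; []; _∷_; length; filter; map)
open import Data.List.Relation.Unary.Linked using (Linked)
open import Data.Bool using (if_then_else_; _∨_)
open import Data.Product using (Σ; _×_; _,_; ∃-syntax)
open import Data.Sum using (_⊎_)
open import Relation.Nullary using (¬_; does)
open import Relation.Binary.PropositionalEquality using (_≡_; _≢_)
open import Relation.Binary.Construct.Closure.ReflexiveTransitive using (Star)
open import Data.List.Base using (allFin)

-- Conventions: [n] is Fin n (0-based), layer index l ∈ [k] is Fin k
-- (0-based; layer zero = π^(1)).  A set partition of [n] is stored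
-- canonically as a vector p with p i = the minimum of the block of i.

SetPart : ℕ → Set
SetPart n = Vec (Fin n) n

ValidPart : ∀ {n} → SetPart n → Set
ValidPart {n} p = (i : Fin n) → (toℕ (lookup p i) ℕ.≤ toℕ i) × (lookup p (lookup p i) ≡ lookup p i)

SameBlock : ∀ {n} → SetPart n → Fin n → Fin n → Set
SameBlock p i j = lookup p i ≡ lookup p j

Refines : ∀ {n} → SetPart n → SetPart n → Set
Refines {n} q p = (i j : Fin n) → SameBlock q i j → SameBlock p i j

Layers : ℕ → ℕ → Set
Layers n k = Vec (SetPart n) k

-- weighted partitions of [n] with k layers (π^(l+1) refines π^(l))
WP : ∀ {n k} → Layers n k → Set
WP {n} {k} ps =
  ((m : Fin k) → ValidPart (lookup ps m)) ×
  ((m m' : Fin k) → toℕ m' ≡ suc (toℕ m) → Refines (lookup ps m') (lookup ps m))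

minF : ∀ {n} → Fin n → Fin n → Fin n
minF a b = if does (a ≤ᶠ? b) then a else b

mergeBlocks : ∀ {n} → SetPart n → Fin n → Fin n → SetPart n
mergeBlocks p a b = tabulate λ i →
  if does (lookup p i ≟ lookup p a) ∨ does (lookup p i ≟ lookup p b)
  then minF (lookup p a) (lookup p b)
  else lookup p i

mergeAt : ∀ {n k} → Layers n k → Fin k → Fin n → Fin n → Layers n k
mergeAt ps l α β = tabulate λ m →
  if does (toℕ m ℕ.≤? toℕ l) then mergeBlocks (lookup ps m) α β else lookup ps m

numBlocks : ∀ {n} → SetPart n → ℕ
numBlocks {n} p = length (filter (λ i → lookup p i ≟ i) (allFin n))

rank : ∀ {n k} → Layers n (suc k) → ℕ
rank {n} ps = n ∸ numBlocks (lookup ps zero)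

Admissible : ∀ {n k} → Layers n (suc k) → Fin (suc k) → Fin n → Fin n → Set
Admissible ps l α β =
  (α Fin.< β) ×
  (¬ SameBlock (lookup ps zero) α β) ×
  (lookup (lookup ps zero) β ≡ β) ×
  (lookup (lookup ps l) α ≡ α)

-- elements of L_n^(k) = P_n^(k) ∪ {1̂} (raw; validity below)
data LElem (n k : ℕ) : Set where
  part : Layers n k → LElem n k
  top  : LElem n k

ValidL : ∀ {n k} → LElem n k → Set
ValidL (part ps) = WP ps
ValidL top = Data.Unit.⊤
  where import Data.Unit

record Label (n k : ℕ) : Set where
  constructor lab
  field
    layer : Fin k
    α     : Fin n
    β     : Fin n

_<L_ : ∀ {n k} → Label n k → Label n k → Set
lab l₁ α₁ β₁ <L lab l₂ α₂ β₂ =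
  (l₂ Fin.< l₁) ⊎
  ((l₁ ≡ l₂) × (α₁ Fin.< α₂)) ⊎
  ((l₁ ≡ l₂) × (α₁ ≡ α₂) × (β₁ Fin.< β₂))

_≤L_ : ∀ {n k} → Label n k → Label n k → Set
x ≤L y = (x <L y) ⊎ (x ≡ y)

data Step : ∀ {n k} → LElem n k → Label n k → LElem n k → Set where
  mergeStep : ∀ {n k} (ps : Layers n (suc k)) (l : Fin (suc k)) (α β : Fin n) →
              WP ps → Admissible ps l α β →
              Step (part ps) (lab l α β) (part (mergeAt ps l α β))
  topStep   : ∀ {n k} (ps : Layers (suc n) (suc k)) →
              WP ps → rank ps ≡ n →
              Step (part ps) (lab (fromℕ k) zero (fromℕ n)) top

Cover : ∀ {n k} → LElem n k → LElem n k → Set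
Cover x y = ∃[ t ] Step x t y

_≤P_ : ∀ {n k} → LElem n k → LElem n k → Set
_≤P_ = Star Cover

-- a maximal chain x = x₀ ⋖ x₁ ⋖ … ⋖ xₘ = y, stored as the list of
-- (label of xᵢ₋₁ ⋖ xᵢ , xᵢ)
IsChain : ∀ {n k} → LElem n k → List (Label n k × LElem n k) → LElem n k → Set
IsChain x [] y = x ≡ y
IsChain x ((t , z) ∷ cs) y = Step x t z × IsChain z cs y

Rising : ∀ {n k} → List (Label n k × LElem n k) → Set
Rising cs = Linked _≤L_ (map Data.Product.proj₁ cs)

FirstStepMinimal : ∀ {n k} → LElem n k → List (Label n k × LElem n k) → LElem n k → Set
FirstStepMinimal {n} {k} x cs y =
  ∀ (t₁ : Label n k) (x₁ : LElem n k) rest → cs ≡ (t₁ , x₁) ∷ rest →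
  ∀ (t : Label n k) (z : LElem n k) → Step x t z → z ≤P y → z ≢ x₁ → t₁ <L t

IsELLabeling : ℕ → ℕ → Set
IsELLabeling n k =
  ∀ (x y : LElem n k) → ValidL x → ValidL y → x ≤P y →
  Σ (List (Label n k × LElem n k)) λ cs →
    IsChain x cs y × Rising cs ×
    (∀ cs' → IsChain x cs' y → Rising cs' → cs' ≡ cs) ×
    FirstStepMinimal x cs y

-- In a rising chain from x to y the first label is the least label of any cover x ⋖ z
-- with z ≤ y. Otherwise some cover x ⋖ z merging α and β in layers up to l has a
-- smaller label (α, β)_l; every label of the chain is then larger, and such merges keep
-- α the minimum of its layer-l block and β outside it, so α and β are still apart in y,
-- although z ≤ y has joined them. Uniqueness of the rising chain and the minimality of
-- its first step follow at once. For existence, xs ≤ ys is described by three block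
-- conditions (_≼_). Merging xs along the least admissible label whose α and β are joined
-- in ys preserves them and lowers the number of blocks, and when no such label exists,
-- xs = ys. Towards the top element one merges along the least admissible (0, b)ₖ until
-- only one block is left; all these labels lie below the label (0, n)ₖ of the last cover.

module Submission where

open import Defs
open import Data.Nat as ℕ using (ℕ; zero; suc; z≤n; s≤s; _∸_; _+_; _≤_)
import Data.Nat.Properties as ℕP
open import Data.Fin using (Fin; zero; suc; toℕ; fromℕ; fromℕ<; _≟_)
  renaming (_≤_ to _≤ᶠ_; _<_ to _<ᶠ_)
import Data.Fin.Properties as FinP
open import Data.Vec using (lookup)
open import Data.Vec.Properties using (lookup∘tabulate; tabulate∘lookup; tabulate-cong)
open import Data.List using (List; []; _∷_; map; length; filter; allFin; cartesianProduct; cartesianProductWith)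
import Data.List.Properties as ListP
open import Data.List.Relation.Unary.All using (All; []; _∷_)
import Data.List.Relation.Unary.All as All
open import Data.List.Relation.Unary.All.Properties using (tabulate⁺)
open import Data.List.Relation.Unary.Any using (here; there)
open import Data.List.Relation.Unary.Linked using (Linked; []; [-]; _∷_)
open import Data.List.Membership.Propositional using (_∈_)
open import Data.List.Membership.Propositional.Properties
  using (∈-filter⁺; ∈-allFin; ∈-cartesianProductWith⁺; ∈-cartesianProduct⁺)
open import Function using (_∘′_)
open import Data.Bool using (if_then_else_; _∨_)
open import Data.Product using (Σ; _×_; _,_; proj₁; proj₂)
open import Data.Sum using (_⊎_; inj₁; inj₂)
open import Data.Empty using (⊥; ⊥-elim)
open import Data.Unit using (⊤; tt)
open import Relation.Nullary using (¬_; Dec; yes; no; does; ¬?)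
open import Relation.Nullary.Decidable using (dec-true; dec-false; _×-dec_)
open import Relation.Unary using (Decidable)
open import Relation.Binary using (tri<; tri≈; tri>)
open import Relation.Binary.PropositionalEquality
open import Relation.Binary.Construct.Closure.ReflexiveTransitive using (ε; _◅_)

private variable
  n k : ℕ

minF-≡ˡ : {a b : Fin n} → a ≤ᶠ b → minF a b ≡ a
minF-≡ˡ {a = a} {b} a≤b = cong (if_then a else b) (dec-true (a FinP.≤? b) a≤b)

minF-≡ʳ : {a b : Fin n} → b <ᶠ a → minF a b ≡ b
minF-≡ʳ {a = a} {b} b<a = cong (if_then a else b) (dec-false (a FinP.≤? b) (ℕP.<⇒≱ b<a))

minF-sel : (a b : Fin n) → (minF a b ≡ a) ⊎ (minF a b ≡ b)
minF-sel a b with a FinP.≤? b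
... | yes a≤b = inj₁ (minF-≡ˡ a≤b)
... | no  a≰b = inj₂ (minF-≡ʳ (ℕP.≰⇒> a≰b))

minF-≤ˡ : (a b : Fin n) → minF a b ≤ᶠ a
minF-≤ˡ a b with a FinP.≤? b
... | yes a≤b = ℕP.≤-reflexive (cong toℕ (minF-≡ˡ a≤b))
... | no  a≰b = subst (_≤ᶠ a) (sym (minF-≡ʳ (ℕP.≰⇒> a≰b))) (ℕP.<⇒≤ (ℕP.≰⇒> a≰b))

minF-≤ʳ : (a b : Fin n) → minF a b ≤ᶠ b
minF-≤ʳ a b with a FinP.≤? b
... | yes a≤b = subst (_≤ᶠ b) (sym (minF-≡ˡ a≤b)) a≤b
... | no  a≰b = ℕP.≤-reflexive (cong toℕ (minF-≡ʳ (ℕP.≰⇒> a≰b)))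

-- Merging blocks

InJoin : SetPart n → Fin n → Fin n → Fin n → Set
InJoin p a b i = SameBlock p i a ⊎ SameBlock p i b

inJoin? : (p : SetPart n) (a b i : Fin n) →
          InJoin p a b i ⊎ (¬ SameBlock p i a × ¬ SameBlock p i b)
inJoin? p a b i with lookup p i ≟ lookup p a | lookup p i ≟ lookup p b
... | yes ia | _      = inj₁ (inj₁ ia)
... | no _   | yes ib = inj₁ (inj₂ ib)
... | no ¬ia | no ¬ib = inj₂ (¬ia , ¬ib)

module _ (p : SetPart n) (a b : Fin n) where

  private
    m : Fin n
    m = minF (lookup p a) (lookup p b)

    q : SetPart n
    q = mergeBlocks p a b

    relabel : Fin n → Fin n
    relabel c = if does (c ≟ lookup p a) ∨ does (c ≟ lookup p b) then m else c

    lookup-mergeBlocks : ∀ i → lookup q i ≡ relabel (lookup p i)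
    lookup-mergeBlocks = lookup∘tabulate _

  lookup-mergeBlocks-∈ : ∀ i → InJoin p a b i → lookup q i ≡ m
  lookup-mergeBlocks-∈ i i∈ = trans (lookup-mergeBlocks i) (relabel-∈ i∈)
    where
    relabel-∈ : ∀ {c} → c ≡ lookup p a ⊎ c ≡ lookup p b → relabel c ≡ m
    relabel-∈ {c} c∈ with c ≟ lookup p a | c ≟ lookup p b | c∈
    ... | yes _ | _     | _       = refl
    ... | no _  | yes _ | _       = refl
    ... | no ¬a | no _  | inj₁ ca = ⊥-elim (¬a ca)
    ... | no _  | no ¬b | inj₂ cb = ⊥-elim (¬b cb)

  lookup-mergeBlocks-∉ : ∀ i → ¬ SameBlock p i a → ¬ SameBlock p i b → lookup q i ≡ lookup p i
  lookup-mergeBlocks-∉ i ¬ia ¬ib rewrite lookup-mergeBlocks i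
    with lookup p i ≟ lookup p a | lookup p i ≟ lookup p b
  ... | yes ia | _      = ⊥-elim (¬ia ia)
  ... | no _   | yes ib = ⊥-elim (¬ib ib)
  ... | no _   | no _   = refl

  mergeBlocks-preserves : ∀ {i j} → SameBlock p i j → SameBlock q i j
  mergeBlocks-preserves {i} {j} ij =
    trans (lookup-mergeBlocks i) (trans (cong relabel ij) (sym (lookup-mergeBlocks j)))

  mergeBlocks-joins : SameBlock q a b
  mergeBlocks-joins =
    trans (lookup-mergeBlocks-∈ a (inj₁ refl)) (sym (lookup-mergeBlocks-∈ b (inj₂ refl)))

  minF-∉ : ∀ j → ¬ SameBlock p j a → ¬ SameBlock p j b → m ≢ lookup p j
  minF-∉ j ¬ja ¬jb e with minF-sel (lookup p a) (lookup p b)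
  ... | inj₁ ma = ¬ja (trans (sym e) ma)
  ... | inj₂ mb = ¬jb (trans (sym e) mb)

  mergeBlocks-reflects : ∀ {i j} → SameBlock q i j →
                         SameBlock p i j ⊎ (InJoin p a b i × InJoin p a b j)
  mergeBlocks-reflects {i} {j} ij with inJoin? p a b i | inJoin? p a b j
  ... | inj₁ i∈ | inj₁ j∈ = inj₂ (i∈ , j∈)
  ... | inj₁ i∈ | inj₂ (¬ja , ¬jb) = ⊥-elim (minF-∉ j ¬ja ¬jb
          (trans (sym (lookup-mergeBlocks-∈ i i∈)) (trans ij (lookup-mergeBlocks-∉ j ¬ja ¬jb))))
  ... | inj₂ (¬ia , ¬ib) | inj₁ j∈ = ⊥-elim (minF-∉ i ¬ia ¬ib
          (trans (sym (lookup-mergeBlocks-∈ j j∈)) (trans (sym ij) (lookup-mergeBlocks-∉ i ¬ia ¬ib))))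
  ... | inj₂ (¬ia , ¬ib) | inj₂ (¬ja , ¬jb) = inj₁
          (trans (sym (lookup-mergeBlocks-∉ i ¬ia ¬ib)) (trans ij (lookup-mergeBlocks-∉ j ¬ja ¬jb)))

  mergeBlocks-valid : ValidPart p → ValidPart q
  mergeBlocks-valid vp i with inJoin? p a b i
  ... | inj₁ i∈ = subst (_≤ᶠ i) (sym qi) (m≤ i i∈) ,
                  trans (cong (lookup q) qi) (trans (lookup-mergeBlocks-∈ m m∈) (sym qi))
    where
    qi : lookup q i ≡ m
    qi = lookup-mergeBlocks-∈ i i∈
    m≤ : ∀ i → InJoin p a b i → m ≤ᶠ i
    m≤ i (inj₁ ia) = ℕP.≤-trans (minF-≤ˡ (lookup p a) (lookup p b)) (subst (_≤ᶠ i) ia (proj₁ (vp i)))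
    m≤ i (inj₂ ib) = ℕP.≤-trans (minF-≤ʳ (lookup p a) (lookup p b)) (subst (_≤ᶠ i) ib (proj₁ (vp i)))
    m∈ : InJoin p a b m
    m∈ with minF-sel (lookup p a) (lookup p b)
    ... | inj₁ ma = inj₁ (trans (cong (lookup p) ma) (proj₂ (vp a)))
    ... | inj₂ mb = inj₂ (trans (cong (lookup p) mb) (proj₂ (vp b)))
  ... | inj₂ (¬ia , ¬ib) = subst (_≤ᶠ i) (sym qi) (proj₁ (vp i)) ,
                  trans (cong (lookup q) qi)
                    (trans (lookup-mergeBlocks-∉ (lookup p i) (¬ia ∘′ trans (sym pii)) (¬ib ∘′ trans (sym pii)))
                      (trans pii (sym qi)))
    where
    qi : lookup q i ≡ lookup p i
    qi = lookup-mergeBlocks-∉ i ¬ia ¬ib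
    pii : lookup p (lookup p i) ≡ lookup p i
    pii = proj₂ (vp i)

mergeBlocks-mono : (p′ p : SetPart n) (a b : Fin n) → Refines p′ p →
                   Refines (mergeBlocks p′ a b) (mergeBlocks p a b)
mergeBlocks-mono p′ p a b r i j ij with mergeBlocks-reflects p′ a b ij
... | inj₁ ij′ = mergeBlocks-preserves p a b (r i j ij′)
... | inj₂ (i∈ , j∈) =
  trans (lookup-mergeBlocks-∈ p a b i (lift i∈)) (sym (lookup-mergeBlocks-∈ p a b j (lift j∈)))
  where
  lift : ∀ {i} → InJoin p′ a b i → InJoin p a b i
  lift {i} (inj₁ ia) = inj₁ (r i a ia)
  lift {i} (inj₂ ib) = inj₂ (r i b ib)

rep : Layers n k → Fin k → Fin n → Fin n
rep ps m i = lookup (lookup ps m) i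

module _ (ps : Layers n k) (l : Fin k) (α β : Fin n) where

  private
    merged : Fin k → SetPart n
    merged m = if does (toℕ m ℕ.≤? toℕ l) then mergeBlocks (lookup ps m) α β else lookup ps m

  lookup-mergeAt-≤ : ∀ m → m ≤ᶠ l → lookup (mergeAt ps l α β) m ≡ mergeBlocks (lookup ps m) α β
  lookup-mergeAt-≤ m m≤l =
    trans (lookup∘tabulate merged m) (cong (if_then _ else _) (dec-true (toℕ m ℕ.≤? toℕ l) m≤l))

  lookup-mergeAt-> : ∀ m → l <ᶠ m → lookup (mergeAt ps l α β) m ≡ lookup ps m
  lookup-mergeAt-> m l<m =
    trans (lookup∘tabulate merged m) (cong (if_then _ else _) (dec-false (toℕ m ℕ.≤? toℕ l) (ℕP.<⇒≱ l<m)))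

  mergeAt-preserves : ∀ m {i j} → SameBlock (lookup ps m) i j →
                      SameBlock (lookup (mergeAt ps l α β) m) i j
  mergeAt-preserves m ij with toℕ m ℕ.≤? toℕ l
  ... | yes m≤l rewrite lookup-mergeAt-≤ m m≤l = mergeBlocks-preserves (lookup ps m) α β ij
  ... | no  m≰l rewrite lookup-mergeAt-> m (ℕP.≰⇒> m≰l) = ij

  mergeAt-joins : ∀ m → m ≤ᶠ l → SameBlock (lookup (mergeAt ps l α β) m) α β
  mergeAt-joins m m≤l rewrite lookup-mergeAt-≤ m m≤l = mergeBlocks-joins (lookup ps m) α β

  mergeAt-WP : WP ps → WP (mergeAt ps l α β)
  mergeAt-WP (valid , refines) = valid′ , refines′
    where
    valid′ : ∀ m → ValidPart (lookup (mergeAt ps l α β) m)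
    valid′ m with toℕ m ℕ.≤? toℕ l
    ... | yes m≤l rewrite lookup-mergeAt-≤ m m≤l = mergeBlocks-valid (lookup ps m) α β (valid m)
    ... | no  m≰l rewrite lookup-mergeAt-> m (ℕP.≰⇒> m≰l) = valid m
    refines′ : ∀ m m′ → toℕ m′ ≡ suc (toℕ m) →
               Refines (lookup (mergeAt ps l α β) m′) (lookup (mergeAt ps l α β) m)
    refines′ m m′ m′≡ with toℕ m′ ℕ.≤? toℕ l | toℕ m ℕ.≤? toℕ l
    ... | yes m′≤l | yes m≤l rewrite lookup-mergeAt-≤ m m≤l | lookup-mergeAt-≤ m′ m′≤l =
      mergeBlocks-mono (lookup ps m′) (lookup ps m) α β (refines m m′ m′≡)
    ... | yes m′≤l | no m≰l = ⊥-elim (m≰l (ℕP.≤-trans (subst (toℕ m ℕ.≤_) (sym m′≡) (ℕP.n≤1+n _)) m′≤l))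
    ... | no m′≰l | yes m≤l rewrite lookup-mergeAt-≤ m m≤l | lookup-mergeAt-> m′ (ℕP.≰⇒> m′≰l) =
      λ i j ij → mergeBlocks-preserves (lookup ps m) α β (refines m m′ m′≡ i j ij)
    ... | no m′≰l | no m≰l rewrite lookup-mergeAt-> m (ℕP.≰⇒> m≰l) | lookup-mergeAt-> m′ (ℕP.≰⇒> m′≰l) =
      refines m m′ m′≡

module WeightedPartition (ps : Layers n (suc k)) (wp : WP ps) where

  rep≤ : ∀ m i → rep ps m i ≤ᶠ i
  rep≤ m i = proj₁ (proj₁ wp m i)

  rep-idem : ∀ m i → rep ps m (rep ps m i) ≡ rep ps m i
  rep-idem m i = proj₂ (proj₁ wp m i)

  refines : ∀ l m → m ≤ᶠ l → Refines (lookup ps l) (lookup ps m)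
  refines l m = go (toℕ l) l m refl
    where
    go : ∀ d l m → toℕ l ≡ d → toℕ m ℕ.≤ d → Refines (lookup ps l) (lookup ps m)
    go zero l m l≡0 m≤0 rewrite FinP.toℕ-injective (trans l≡0 (sym (ℕP.n≤0⇒n≡0 m≤0))) =
      λ _ _ ij → ij
    go (suc d) l m l≡ m≤ with toℕ m ℕ.≟ suc d
    ... | yes m≡ rewrite FinP.toℕ-injective (trans l≡ (sym m≡)) = λ _ _ ij → ij
    ... | no  m≢ = λ i j ij →
      go d l′ m (FinP.toℕ-fromℕ< d<) (ℕP.≤-pred (ℕP.≤∧≢⇒< m≤ m≢)) i j
         (proj₂ wp l′ l (trans l≡ (cong suc (sym (FinP.toℕ-fromℕ< d<)))) i j ij)
      where
      d< : d ℕ.< suc k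
      d< = ℕP.<-trans (ℕP.n<1+n d) (subst (ℕ._< suc k) l≡ (FinP.toℕ<n l))
      l′ : Fin (suc k)
      l′ = fromℕ< d<

  sameBlock-down : ∀ m l {i j} → m ≤ᶠ l → rep ps l i ≡ rep ps l j → rep ps m i ≡ rep ps m j
  sameBlock-down m l m≤l = refines l m m≤l _ _

  sameBlock-base : ∀ m {i j} → rep ps m i ≡ rep ps m j → rep ps zero i ≡ rep ps zero j
  sameBlock-base m = sameBlock-down zero m z≤n

  root-up : ∀ m l {b} → m ≤ᶠ l → rep ps m b ≡ b → rep ps l b ≡ b
  root-up m l {b} m≤l rb = FinP.≤-antisym (rep≤ l b)
    (subst (_≤ᶠ rep ps l b) (trans (sameBlock-down m l m≤l (rep-idem l b)) rb) (rep≤ m (rep ps l b)))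

  root-base-up : ∀ m {b} → rep ps zero b ≡ b → rep ps m b ≡ b
  root-base-up m = root-up zero m z≤n

-- The order on labels

<L-trans : {t s u : Label n k} → t <L s → s <L u → t <L u
<L-trans (inj₁ x) (inj₁ y) = inj₁ (ℕP.<-trans y x)
<L-trans (inj₁ x) (inj₂ (inj₁ (refl , _))) = inj₁ x
<L-trans (inj₁ x) (inj₂ (inj₂ (refl , _))) = inj₁ x
<L-trans (inj₂ (inj₁ (refl , _))) (inj₁ y) = inj₁ y
<L-trans (inj₂ (inj₂ (refl , _))) (inj₁ y) = inj₁ y
<L-trans (inj₂ (inj₁ (refl , x))) (inj₂ (inj₁ (refl , y))) = inj₂ (inj₁ (refl , ℕP.<-trans x y))
<L-trans (inj₂ (inj₁ (refl , x))) (inj₂ (inj₂ (refl , refl , _))) = inj₂ (inj₁ (refl , x))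
<L-trans (inj₂ (inj₂ (refl , refl , _))) (inj₂ (inj₁ (refl , y))) = inj₂ (inj₁ (refl , y))
<L-trans (inj₂ (inj₂ (refl , refl , x))) (inj₂ (inj₂ (refl , refl , y))) =
  inj₂ (inj₂ (refl , refl , ℕP.<-trans x y))

<L-irrefl : {t : Label n k} → ¬ (t <L t)
<L-irrefl (inj₁ x) = ℕP.<-irrefl refl x
<L-irrefl (inj₂ (inj₁ (_ , x))) = ℕP.<-irrefl refl x
<L-irrefl (inj₂ (inj₂ (_ , _ , x))) = ℕP.<-irrefl refl x

≤L-total : (t s : Label n k) → (t ≤L s) ⊎ (s <L t)
≤L-total (lab l₁ a₁ b₁) (lab l₂ a₂ b₂) with FinP.<-cmp l₁ l₂
... | tri< l₁<l₂ _ _ = inj₂ (inj₁ l₁<l₂)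
... | tri> _ _ l₂<l₁ = inj₁ (inj₁ (inj₁ l₂<l₁))
... | tri≈ _ refl _ with FinP.<-cmp a₁ a₂
...   | tri< a₁<a₂ _ _ = inj₁ (inj₁ (inj₂ (inj₁ (refl , a₁<a₂))))
...   | tri> _ _ a₂<a₁ = inj₂ (inj₂ (inj₁ (refl , a₂<a₁)))
...   | tri≈ _ refl _ with FinP.<-cmp b₁ b₂
...     | tri< b₁<b₂ _ _ = inj₁ (inj₁ (inj₂ (inj₂ (refl , refl , b₁<b₂))))
...     | tri> _ _ b₂<b₁ = inj₂ (inj₂ (inj₂ (refl , refl , b₂<b₁)))
...     | tri≈ _ refl _ = inj₁ (inj₂ refl)

≤L-trans : {t s u : Label n k} → t ≤L s → s ≤L u → t ≤L u
≤L-trans (inj₁ t<s) (inj₁ s<u) = inj₁ (<L-trans t<s s<u)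
≤L-trans (inj₁ t<s) (inj₂ refl) = inj₁ t<s
≤L-trans (inj₂ refl) s≤u = s≤u

<-≤L-trans : {t s u : Label n k} → t <L s → s ≤L u → t <L u
<-≤L-trans t<s (inj₁ s<u) = <L-trans t<s s<u
<-≤L-trans t<s (inj₂ refl) = t<s

≤L⇒≯ : {t s : Label n k} → t ≤L s → ¬ (s <L t)
≤L⇒≯ (inj₁ t<s) s<t = <L-irrefl (<L-trans t<s s<t)
≤L⇒≯ (inj₂ refl) s<t = <L-irrefl s<t

≤L-antisym : {t s : Label n k} → t ≤L s → s ≤L t → t ≡ s
≤L-antisym (inj₂ t≡s) _ = t≡s
≤L-antisym (inj₁ t<s) s≤t = ⊥-elim (≤L⇒≯ s≤t t<s)

-- Counting blocks

private
  root? : (p : SetPart n) → Decidable (λ i → lookup p i ≡ i)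
  root? p i = lookup p i ≟ i

  length≥2 : ∀ {A : Set} {a b : A} {xs : List A} → a ∈ xs → b ∈ xs → a ≢ b → 2 ≤ length xs
  length≥2 (here refl) (here refl) a≢b = ⊥-elim (a≢b refl)
  length≥2 (here refl) (there {xs = _ ∷ _} _) _ = s≤s (s≤s z≤n)
  length≥2 (there {xs = _ ∷ _} _) _ _ = s≤s (s≤s z≤n)

  length-filter-⊆ : ∀ {A : Set} {P Q : A → Set} (P? : Decidable P) (Q? : Decidable Q) →
                    (∀ x → Q x → P x) → ∀ xs → length (filter Q? xs) ≤ length (filter P? xs)
  length-filter-⊆ P? Q? Q⊆P [] = z≤n
  length-filter-⊆ P? Q? Q⊆P (y ∷ ys) with P? y | Q? y
  ... | yes _ | yes _ = s≤s (length-filter-⊆ P? Q? Q⊆P ys)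
  ... | no ¬p | yes q = ⊥-elim (¬p (Q⊆P y q))
  ... | yes _ | no _  = ℕP.m≤n⇒m≤1+n (length-filter-⊆ P? Q? Q⊆P ys)
  ... | no _  | no _  = length-filter-⊆ P? Q? Q⊆P ys

  length-filter-⊂ : ∀ {A : Set} {P Q : A → Set} (P? : Decidable P) (Q? : Decidable Q) →
                    (∀ x → Q x → P x) → ∀ {x} xs → x ∈ xs → P x → ¬ Q x →
                    length (filter Q? xs) ℕ.< length (filter P? xs)
  length-filter-⊂ P? Q? Q⊆P (y ∷ ys) (here refl) px ¬qx with P? y | Q? y
  ... | _     | yes q = ⊥-elim (¬qx q)
  ... | no ¬p | no _  = ⊥-elim (¬p px)
  ... | yes _ | no _  = s≤s (length-filter-⊆ P? Q? Q⊆P ys)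
  length-filter-⊂ P? Q? Q⊆P (y ∷ ys) (there x∈) px ¬qx with P? y | Q? y
  ... | yes _ | yes _ = s≤s (length-filter-⊂ P? Q? Q⊆P ys x∈ px ¬qx)
  ... | no ¬p | yes q = ⊥-elim (¬p (Q⊆P y q))
  ... | yes _ | no _  = ℕP.m≤n⇒m≤1+n (length-filter-⊂ P? Q? Q⊆P ys x∈ px ¬qx)
  ... | no _  | no _  = length-filter-⊂ P? Q? Q⊆P ys x∈ px ¬qx

numBlocks≤ : (p : SetPart n) → numBlocks p ≤ n
numBlocks≤ {n} p = subst (numBlocks p ≤_) (ListP.length-tabulate {n = n} (λ i → i))
                         (ListP.length-filter (root? p) (allFin n))

numBlocks≥2 : (p : SetPart n) {a b : Fin n} → lookup p a ≡ a → lookup p b ≡ b → a ≢ b →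
              2 ≤ numBlocks p
numBlocks≥2 p {a} {b} ra rb a≢b =
  length≥2 (∈-filter⁺ (root? p) (∈-allFin a) ra) (∈-filter⁺ (root? p) (∈-allFin b) rb) a≢b

numBlocks≡1 : (p : SetPart (suc n)) → lookup p zero ≡ zero → (∀ i → lookup p i ≡ i → i ≡ zero) →
              numBlocks p ≡ 1
numBlocks≡1 {n} p r0 only0 with lookup p zero ≟ zero
... | no ¬r0 = ⊥-elim (¬r0 r0)
... | yes _  = cong suc (cong length (ListP.filter-none (root? p)
                 (tabulate⁺ {n = n} (λ i ri → FinP.0≢1+n (sym (only0 (suc i) ri))))))

numBlocks-< : (p q : SetPart n) → (∀ i → lookup q i ≡ i → lookup p i ≡ i) →
              ∀ b → lookup p b ≡ b → lookup q b ≢ b → numBlocks q ℕ.< numBlocks p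
numBlocks-< {n} p q roots⊆ b rb ¬rb =
  length-filter-⊂ (root? p) (root? q) roots⊆ (allFin n) (∈-allFin b) rb ¬rb

twoRoots⇒rank≢ : (ps : Layers (suc n) (suc k)) {a b : Fin (suc n)} →
                 rep ps zero a ≡ a → rep ps zero b ≡ b → a ≢ b → rank ps ≢ n
twoRoots⇒rank≢ {n} ps ra rb a≢b rank≡n = ℕP.<-irrefl (sym blocks≡1) (numBlocks≥2 p ra rb a≢b)
  where
  p : SetPart (suc n)
  p = lookup ps zero
  blocks≡1 : numBlocks p ≡ 1
  blocks≡1 = ℕP.+-cancelˡ-≡ n (numBlocks p) 1 (begin
    n + numBlocks p             ≡⟨ cong (_+ numBlocks p) (sym rank≡n) ⟩
    rank ps + numBlocks p       ≡⟨ ℕP.m∸n+n≡m (numBlocks≤ p) ⟩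
    suc n                       ≡⟨ ℕP.+-comm 1 n ⟩
    n + 1                       ∎)
    where open ≡-Reasoning

-- Chains

Chain : ℕ → ℕ → Set
Chain n k = List (Label n k × LElem n k)

chain⇒≤P : {x y : LElem n k} {cs : Chain n k} → IsChain x cs y → x ≤P y
chain⇒≤P {cs = []} refl = ε
chain⇒≤P {cs = (t , z) ∷ cs} (x⋖z , z⇝y) = (t , x⋖z) ◅ chain⇒≤P z⇝y

top≤P⇒≡top : {y : LElem n k} → top ≤P y → y ≡ top
top≤P⇒≡top ε = refl
top≤P⇒≡top ((_ , ()) ◅ _)

chain-from-top : {y : LElem n k} {cs : Chain n k} → IsChain top cs y →
                 (cs ≡ []) × (y ≡ top)
chain-from-top {cs = []} refl = refl , refl
chain-from-top {cs = _ ∷ _} (() , _)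

≤P-preserves-sameBlock : {xs ys : Layers n k} → part xs ≤P part ys → ∀ m {i j} →
                         SameBlock (lookup xs m) i j → SameBlock (lookup ys m) i j
≤P-preserves-sameBlock ε m ij = ij
≤P-preserves-sameBlock ((_ , mergeStep ps l α β _ _) ◅ rest) m ij =
  ≤P-preserves-sameBlock rest m (mergeAt-preserves ps l α β m ij)
≤P-preserves-sameBlock ((_ , topStep _ _ _) ◅ rest) m ij with top≤P⇒≡top rest
... | ()

admissible⇒rank≢ : (ps : Layers (suc n) (suc k)) {l : Fin (suc k)} {α β : Fin (suc n)} →
                   WP ps → Admissible ps l α β → rank ps ≢ n
admissible⇒rank≢ ps {α = α} wp (_ , α≁β , rβ , _) =
  twoRoots⇒rank≢ ps (WeightedPartition.rep-idem ps wp zero α) rβ (λ e → α≁β (trans e (sym rβ)))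

Step-functional : {x z z′ : LElem n k} {t : Label n k} → Step x t z → Step x t z′ → z ≡ z′
Step-functional (mergeStep _ _ _ _ _ _) (mergeStep _ _ _ _ _ _) = refl
Step-functional (topStep _ _ _) (topStep _ _ _) = refl
Step-functional (mergeStep ps _ _ _ wp adm) (topStep _ _ rk) = ⊥-elim (admissible⇒rank≢ ps wp adm rk)
Step-functional (topStep ps _ rk) (mergeStep _ _ _ _ wp adm) = ⊥-elim (admissible⇒rank≢ ps wp adm rk)

chain-acyclic : {x z : LElem n k} {t : Label n k} {cs : Chain n k} →
                ¬ IsChain x ((t , z) ∷ cs) x
chain-acyclic (mergeStep ps l α β _ (_ , α≁β , _ , _) , z⇝x) =
  α≁β (≤P-preserves-sameBlock (chain⇒≤P z⇝x) zero (mergeAt-joins ps l α β zero z≤n))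
chain-acyclic (topStep _ _ _ , top⇝x) with proj₂ (chain-from-top top⇝x)
... | ()

-- The first label of a rising chain

Separated : Layers n (suc k) → Fin (suc k) → Fin n → Fin n → Set
Separated ps l α β = (rep ps l α ≡ α) × (rep ps l β ≢ α)

-- The labels above (α, β)_l, with l′ ≡ l relaxed to l ≤ l′ in the middle case so that the
-- chains to the top element are covered as well.
KeepsApart : Fin (suc k) → Fin n → Fin n → Label n (suc k) → Set
KeepsApart l α β (lab l′ α′ β′) =
  (l′ <ᶠ l) ⊎ ((l ≤ᶠ l′) × (α ≡ α′) × (β <ᶠ β′)) ⊎ ((l′ ≡ l) × (α <ᶠ α′))

mergeBlocks-keeps-apart : (p : SetPart n) → ValidPart p → {α β a b : Fin n} →
                          lookup p α ≡ α → lookup p β ≢ α → lookup p a ≡ a → lookup p b ≡ b →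
                          a <ᶠ b → (α <ᶠ a) ⊎ ((α ≡ a) × (β <ᶠ b)) →
                          (lookup (mergeBlocks p a b) α ≡ α) × (lookup (mergeBlocks p a b) β ≢ α)
mergeBlocks-keeps-apart {n} p vp {α} {β} {a} {b} rα β≁α ra rb a<b order = keepα order , keepβ order
  where
  q : SetPart n
  q = mergeBlocks p a b
  m≡a : minF (lookup p a) (lookup p b) ≡ a
  m≡a = trans (cong₂ minF ra rb) (minF-≡ˡ (ℕP.<⇒≤ a<b))
  keepα : (α <ᶠ a) ⊎ ((α ≡ a) × (β <ᶠ b)) → lookup q α ≡ α
  keepα (inj₁ α<a) = trans (lookup-mergeBlocks-∉ p a b α
    (λ e → ℕP.<-irrefl (cong toℕ (trans (sym rα) (trans e ra))) α<a)
    (λ e → ℕP.<-irrefl (cong toℕ (trans (sym rα) (trans e rb))) (ℕP.<-trans α<a a<b))) rα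
  keepα (inj₂ (refl , _)) = trans (lookup-mergeBlocks-∈ p a b α (inj₁ refl)) m≡a
  keepβ : (α <ᶠ a) ⊎ ((α ≡ a) × (β <ᶠ b)) → lookup q β ≢ α
  keepβ _ qβ≡α with inJoin? p a b β
  keepβ (inj₁ α<a) qβ≡α | inj₁ β∈ =
    ℕP.<-irrefl (cong toℕ (trans (sym qβ≡α) (trans (lookup-mergeBlocks-∈ p a b β β∈) m≡a))) α<a
  keepβ (inj₂ (refl , _)) _ | inj₁ (inj₁ βa) = β≁α (trans βa rα)
  keepβ (inj₂ (refl , β<b)) _ | inj₁ (inj₂ βb) =
    ℕP.<⇒≱ β<b (subst (_≤ᶠ β) (trans βb rb) (proj₁ (vp β)))
  keepβ _ qβ≡α | inj₂ (¬βa , ¬βb) = β≁α (trans (sym (lookup-mergeBlocks-∉ p a b β ¬βa ¬βb)) qβ≡α)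

mergeAt-keeps-separated : (ps : Layers n (suc k)) (l : Fin (suc k)) (α β : Fin n) {l′ : Fin (suc k)}
                          {α′ β′ : Fin n} → WP ps → Admissible ps l′ α′ β′ → Separated ps l α β →
                          KeepsApart l α β (lab l′ α′ β′) → Separated (mergeAt ps l′ α′ β′) l α β
mergeAt-keeps-separated ps l α β {l′} {α′} {β′} wp _ sep (inj₁ l′<l)
  rewrite lookup-mergeAt-> ps l′ α′ β′ l l′<l = sep
mergeAt-keeps-separated ps l α β {l′} {β′ = β′} wp (α<β′ , _ , rβ′ , _) (rα , β≁α)
                        (inj₂ (inj₁ (l≤l′ , refl , β<β′)))
  rewrite lookup-mergeAt-≤ ps l′ α β′ l l≤l′ =
  mergeBlocks-keeps-apart (lookup ps l) (proj₁ wp l) rα β≁α rα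
    (WeightedPartition.root-base-up ps wp l rβ′) α<β′ (inj₂ (refl , β<β′))
mergeAt-keeps-separated ps l α β {α′ = α′} {β′} wp (α′<β′ , _ , rβ′ , rα′) (rα , β≁α)
                        (inj₂ (inj₂ (refl , α<α′)))
  rewrite lookup-mergeAt-≤ ps l α′ β′ l ℕP.≤-refl =
  mergeBlocks-keeps-apart (lookup ps l) (proj₁ wp l) rα β≁α rα′
    (WeightedPartition.root-base-up ps wp l rβ′) α′<β′ (inj₁ α<α′)

SeparatedAtEnd : Fin (suc k) → Fin n → Fin n → LElem n (suc k) → Set
SeparatedAtEnd l α β (part qs) = Separated qs l α β
SeparatedAtEnd {k} {n} l α β top =
  Σ (Layers n (suc k)) λ ps → WP ps × Separated ps l α β × Σ (Label n (suc k)) λ t → Step (part ps) t top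

chain-keeps-separated : (l : Fin (suc k)) (α β : Fin n) {ps : Layers n (suc k)}
                        {cs : Chain n (suc k)} {y : LElem n (suc k)} →
                        Separated ps l α β → IsChain (part ps) cs y →
                        All (KeepsApart l α β) (map proj₁ cs) → SeparatedAtEnd l α β y
chain-keeps-separated l α β {cs = []} sep refl [] = sep
chain-keeps-separated l α β {cs = _ ∷ _} sep (mergeStep ps _ _ _ wp adm , z⇝y) (keeps ∷ keepss) =
  chain-keeps-separated l α β (mergeAt-keeps-separated ps l α β wp adm sep keeps) z⇝y keepss
chain-keeps-separated l α β {cs = _ ∷ _} sep (topStep ps wp rk , top⇝y) _ with chain-from-top top⇝y
... | refl , refl = ps , wp , sep , _ , topStep ps wp rk

topLabel : ∀ n k → Label (suc n) (suc k)
topLabel n k = lab (fromℕ k) zero (fromℕ n)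

rising-tail : {c : Label n k × LElem n k} {cs : Chain n k} →
              Rising (c ∷ cs) → Rising cs
rising-tail {cs = []} _ = []
rising-tail {cs = _ ∷ _} (_ ∷ r) = r

rising-above : {t t₁ : Label n k} {ts : List (Label n k)} →
               Linked _≤L_ (t₁ ∷ ts) → t <L t₁ → All (t <L_) (t₁ ∷ ts)
rising-above [-] t<t₁ = t<t₁ ∷ []
rising-above (t₁≤t₂ ∷ r) t<t₁ = t<t₁ ∷ rising-above r (<-≤L-trans t<t₁ t₁≤t₂)

rising-to-top : {x : LElem (suc n) (suc k)} {cs : Chain (suc n) (suc k)} →
                IsChain x cs top → Rising cs → All (_≤L topLabel n k) (map proj₁ cs)
rising-to-top {cs = []} _ _ = []
rising-to-top {cs = _ ∷ []} (topStep _ _ _ , refl) _ = inj₂ refl ∷ []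
rising-to-top {cs = _ ∷ _ ∷ _} (_ , c) (t≤t′ ∷ r) with rising-to-top c r
... | t′≤T ∷ ts≤T = ≤L-trans t≤t′ t′≤T ∷ t′≤T ∷ ts≤T

<L⇒KeepsApart : {l : Fin (suc k)} {α β : Fin n} {t : Label n (suc k)} → lab l α β <L t → KeepsApart l α β t
<L⇒KeepsApart (inj₁ l′<l) = inj₁ l′<l
<L⇒KeepsApart (inj₂ (inj₁ (refl , α<α′))) = inj₂ (inj₂ (refl , α<α′))
<L⇒KeepsApart (inj₂ (inj₂ (refl , refl , β<β′))) = inj₂ (inj₁ (ℕP.≤-refl , refl , β<β′))

fromℕ-maximal : (l : Fin (suc k)) → ¬ (fromℕ k <ᶠ l)
fromℕ-maximal {k} l k<l =
  ℕP.<⇒≱ k<l (subst (toℕ l ℕ.≤_) (sym (FinP.toℕ-fromℕ k)) (ℕP.≤-pred (FinP.toℕ<n l)))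

<topLabel⇒top-layer : {l : Fin (suc k)} {α β : Fin (suc n)} → lab l α β <L topLabel n k →
                      (l ≡ fromℕ k) × (α ≡ zero)
<topLabel⇒top-layer {l = l} (inj₁ k<l) = ⊥-elim (fromℕ-maximal l k<l)
<topLabel⇒top-layer (inj₂ (inj₂ (refl , refl , _))) = refl , refl

-- Strictly between (0, β)ₖ and the top label lie only labels (0, β′)ₖ with β < β′, and these keep
-- 0 and β apart even in layer zero.
between-topLabel⇒KeepsApart : {β : Fin (suc n)} {t : Label (suc n) (suc k)} →
                              lab (fromℕ k) zero β <L t → t ≤L topLabel n k → KeepsApart zero zero β t
between-topLabel⇒KeepsApart {t = lab l′ _ _} _ (inj₁ (inj₁ k<l′)) = ⊥-elim (fromℕ-maximal l′ k<l′)
between-topLabel⇒KeepsApart (inj₁ k<k) (inj₁ (inj₂ (inj₂ (refl , refl , _)))) = ⊥-elim (ℕP.<-irrefl refl k<k)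
between-topLabel⇒KeepsApart (inj₂ (inj₂ (_ , _ , β<β′))) (inj₁ (inj₂ (inj₂ (refl , refl , _)))) =
  inj₂ (inj₁ (z≤n , refl , β<β′))
between-topLabel⇒KeepsApart (inj₁ k<k) (inj₂ refl) = ⊥-elim (ℕP.<-irrefl refl k<k)
between-topLabel⇒KeepsApart (inj₂ (inj₂ (_ , _ , β<β′))) (inj₂ refl) = inj₂ (inj₁ (z≤n , refl , β<β′))

private
  label-Separated : (ps : Layers n (suc k)) {l : Fin (suc k)} {α β : Fin n} →
                    WP ps → Admissible ps l α β → Separated ps l α β
  label-Separated ps {l} {α} wp (α<β , _ , rβ , rα) =
    rα , λ rβ≡α → ℕP.<-irrefl (cong toℕ (trans (sym rβ≡α) (WeightedPartition.root-base-up ps wp l rβ))) α<β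

  -- The chain keeps α and β apart in layer l up to y, but z ≤ y has them together.
  smaller-label-below-part : {ps qs : Layers n (suc k)} {l : Fin (suc k)} {α β : Fin n}
                             {t₁ : Label n (suc k)} {x₁ : LElem n (suc k)} {rest : Chain n (suc k)} →
                             IsChain (part ps) ((t₁ , x₁) ∷ rest) (part qs) → Rising ((t₁ , x₁) ∷ rest) →
                             WP ps → Admissible ps l α β → part (mergeAt ps l α β) ≤P part qs →
                             lab l α β <L t₁ → ⊥
  smaller-label-below-part {ps = ps} {qs} {l} {α} {β} c r wp adm z≤y t<t₁ = β≁α (trans (sym αβ) rα)
    where
    sep : Separated qs l α β
    sep = chain-keeps-separated l α β (label-Separated ps wp adm) c
            (All.map <L⇒KeepsApart (rising-above r t<t₁))
    rα : rep qs l α ≡ α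
    rα = proj₁ sep
    β≁α : rep qs l β ≢ α
    β≁α = proj₂ sep
    αβ : rep qs l α ≡ rep qs l β
    αβ = ≤P-preserves-sameBlock z≤y l (mergeAt-joins ps l α β l ℕP.≤-refl)

  -- Below the top, the chain keeps the roots 0 and β of layer zero apart, so it never reaches rank n.
  smaller-label-below-top : {ps : Layers (suc n) (suc k)} {β : Fin (suc n)} {t₁ : Label (suc n) (suc k)}
                            {x₁ : LElem (suc n) (suc k)} {rest : Chain (suc n) (suc k)} →
                            IsChain (part ps) ((t₁ , x₁) ∷ rest) top → Rising ((t₁ , x₁) ∷ rest) →
                            WP ps → Admissible ps (fromℕ k) zero β →
                            lab (fromℕ k) zero β <L t₁ → t₁ ≤L topLabel n k →
                            All (_≤L topLabel n k) (map proj₁ rest) → ⊥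
  smaller-label-below-top {ps = ps} {β} c r wp (0<β , _ , rβ , _) t<t₁ t₁≤T rest≤T
    with chain-keeps-separated zero zero β sep₀ c
           (All.zipWith (λ (t<t′ , t′≤T) → between-topLabel⇒KeepsApart t<t′ t′≤T)
                        (rising-above r t<t₁ , t₁≤T ∷ rest≤T))
    where
    sep₀ : Separated ps zero zero β
    sep₀ = FinP.≤-antisym (WeightedPartition.rep≤ ps wp zero zero) z≤n ,
           λ rβ≡0 → ℕP.<-irrefl (cong toℕ (trans (sym rβ≡0) rβ)) 0<β
  ... | ps′ , wp′ , (r0 , rβ′≢0) , _ , topStep _ _ rk =
    twoRoots⇒rank≢ ps′ r0 (WeightedPartition.rep-idem ps′ wp′ zero β) (λ e → rβ′≢0 (sym e)) rk

no-smaller-first-label : {x y z x₁ : LElem n (suc k)} {t₁ t : Label n (suc k)} {rest : Chain n (suc k)} →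
                         IsChain x ((t₁ , x₁) ∷ rest) y → Rising ((t₁ , x₁) ∷ rest) →
                         Step x t z → z ≤P y → ¬ (t <L t₁)
no-smaller-first-label (mergeStep ps _ _ _ wp adm , _) _ (topStep _ _ rk) _ _ = admissible⇒rank≢ ps wp adm rk
no-smaller-first-label (topStep _ _ _ , _) _ (topStep _ _ _) _ t<t₁ = <L-irrefl t<t₁
no-smaller-first-label {y = part qs} c r (mergeStep ps l α β wp adm) z≤y t<t₁ =
  smaller-label-below-part c r wp adm z≤y t<t₁
no-smaller-first-label {n = suc n} {y = top} c r (mergeStep ps l α β wp adm) z≤y t<t₁
  with rising-to-top c r
... | t₁≤T ∷ rest≤T with <topLabel⇒top-layer (<-≤L-trans t<t₁ t₁≤T)
... | refl , refl = smaller-label-below-top c r wp adm t<t₁ t₁≤T rest≤T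

firstLabel-minimal : {x y z x₁ : LElem n (suc k)} {t₁ t : Label n (suc k)} {rest : Chain n (suc k)} →
                     IsChain x ((t₁ , x₁) ∷ rest) y → Rising ((t₁ , x₁) ∷ rest) →
                     Step x t z → z ≤P y → t₁ ≤L t
firstLabel-minimal {t₁ = t₁} {t} c r s z≤y with ≤L-total t₁ t
... | inj₁ t₁≤t = t₁≤t
... | inj₂ t<t₁ = ⊥-elim (no-smaller-first-label c r s z≤y t<t₁)

rising-unique : {x y : LElem n (suc k)} (cs cs′ : Chain n (suc k)) →
                IsChain x cs y → Rising cs → IsChain x cs′ y → Rising cs′ → cs′ ≡ cs
rising-unique [] [] _ _ _ _ = refl
rising-unique [] (_ ∷ _) refl _ c′ _ = ⊥-elim (chain-acyclic c′)
rising-unique (_ ∷ _) [] c _ refl _ = ⊥-elim (chain-acyclic c)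
rising-unique ((t₁ , x₁) ∷ cs) ((t₁′ , x₁′) ∷ cs′) (s , c) r (s′ , c′) r′
  with ≤L-antisym (firstLabel-minimal (s′ , c′) r′ s (chain⇒≤P c))
                  (firstLabel-minimal (s , c) r s′ (chain⇒≤P c′))
... | refl with Step-functional s′ s
... | refl = cong ((t₁ , x₁) ∷_)
  (rising-unique cs cs′ c (rising-tail {c = t₁ , x₁} r) c′ (rising-tail {c = t₁ , x₁} r′))

rising⇒FirstStepMinimal : {x y : LElem n (suc k)} (cs : Chain n (suc k)) →
                          IsChain x cs y → Rising cs → FirstStepMinimal x cs y
rising⇒FirstStepMinimal cs (s₁ , c) r _ _ _ refl t z s z≤y z≢x₁ with firstLabel-minimal (s₁ , c) r s z≤y
... | inj₁ t₁<t = t₁<t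
... | inj₂ refl = ⊥-elim (z≢x₁ (Step-functional s s₁))

module AdmissibleMerge (xs : Layers n (suc k)) (l : Fin (suc k)) (α β : Fin n)
                       (wp : WP xs) (adm : Admissible xs l α β) where

  zs : Layers n (suc k)
  zs = mergeAt xs l α β

  zs-WP : WP zs
  zs-WP = mergeAt-WP xs l α β wp

  open WeightedPartition xs wp public
  private
    module Z = WeightedPartition zs zs-WP

  α≁β : rep xs zero α ≢ rep xs zero β
  α≁β = proj₁ (proj₂ adm)

  rβ₀ : rep xs zero β ≡ β
  rβ₀ = proj₁ (proj₂ (proj₂ adm))

  rβ : ∀ m → rep xs m β ≡ β
  rβ m = root-base-up m rβ₀

  rep-α<β : ∀ m → rep xs m α <ᶠ β
  rep-α<β m = ℕP.≤-<-trans (rep≤ m α) (proj₁ adm)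

  rep-zs-≤ : ∀ m → m ≤ᶠ l → ∀ i → rep zs m i ≡ lookup (mergeBlocks (lookup xs m) α β) i
  rep-zs-≤ m m≤l i = cong (λ p → lookup p i) (lookup-mergeAt-≤ xs l α β m m≤l)

  rep-zs-> : ∀ m → l <ᶠ m → ∀ i → rep zs m i ≡ rep xs m i
  rep-zs-> m l<m i = cong (λ p → lookup p i) (lookup-mergeAt-> xs l α β m l<m)

  rep-zs-∈ : ∀ m → m ≤ᶠ l → ∀ i → InJoin (lookup xs m) α β i → rep zs m i ≡ rep xs m α
  rep-zs-∈ m m≤l i i∈ = begin
    rep zs m i                                    ≡⟨ rep-zs-≤ m m≤l i ⟩
    lookup (mergeBlocks (lookup xs m) α β) i      ≡⟨ lookup-mergeBlocks-∈ (lookup xs m) α β i i∈ ⟩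
    minF (rep xs m α) (rep xs m β)                ≡⟨ cong (minF (rep xs m α)) (rβ m) ⟩
    minF (rep xs m α) β                           ≡⟨ minF-≡ˡ (ℕP.<⇒≤ (rep-α<β m)) ⟩
    rep xs m α                                    ∎
    where open ≡-Reasoning

  rep-zs-∉ : ∀ m i → rep xs m i ≢ rep xs m α → rep xs m i ≢ rep xs m β → rep zs m i ≡ rep xs m i
  rep-zs-∉ m i ¬iα ¬iβ with toℕ m ℕ.≤? toℕ l
  ... | yes m≤l = trans (rep-zs-≤ m m≤l i) (lookup-mergeBlocks-∉ (lookup xs m) α β i ¬iα ¬iβ)
  ... | no  m≰l = rep-zs-> m (ℕP.≰⇒> m≰l) i

  rep-zs-preserves : ∀ m {i j} → rep xs m i ≡ rep xs m j → rep zs m i ≡ rep zs m j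
  rep-zs-preserves = mergeAt-preserves xs l α β

  rep-zs≤rep : ∀ m i → rep zs m i ≤ᶠ rep xs m i
  rep-zs≤rep m i = subst (_≤ᶠ rep xs m i) (sym (rep-zs-preserves m (sym (rep-idem m i)))) (Z.rep≤ m (rep xs m i))

  root-zs⇒root : ∀ m i → rep zs m i ≡ i → rep xs m i ≡ i
  root-zs⇒root m i e = FinP.≤-antisym (rep≤ m i) (subst (_≤ᶠ rep xs m i) e (rep-zs≤rep m i))

  nonroot⇒nonroot-zs : ∀ m b → rep xs m b ≢ b → rep zs m b ≢ b
  nonroot⇒nonroot-zs m b ¬rb e =
    ℕP.<-irrefl (cong toℕ e) (ℕP.≤-<-trans (rep-zs≤rep m b) (ℕP.≤∧≢⇒< (rep≤ m b) (¬rb ∘′ FinP.toℕ-injective)))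

  β-nonroot-zs : rep zs zero β ≢ β
  β-nonroot-zs e = ℕP.<-irrefl (cong toℕ (trans (sym (rep-zs-∈ zero z≤n β (inj₂ refl))) e)) (rep-α<β zero)

  admissible-zs⇒admissible : ∀ {l′ a b} → Admissible zs l′ a b → Admissible xs l′ a b
  admissible-zs⇒admissible (a<b , a≁b , rb , ra) =
    a<b , a≁b ∘′ rep-zs-preserves zero , root-zs⇒root zero _ rb , root-zs⇒root _ _ ra

  lost-root≡β : ∀ b → rep xs zero b ≡ b → rep zs zero b ≢ b → b ≡ β
  lost-root≡β b rb ¬rb′ with inJoin? (lookup xs zero) α β b
  ... | inj₂ (¬bα , ¬bβ) = ⊥-elim (¬rb′ (trans (rep-zs-∉ zero b ¬bα ¬bβ) rb))
  ... | inj₁ (inj₁ bα) = ⊥-elim (¬rb′ (trans (rep-zs-∈ zero z≤n b (inj₁ bα)) (trans (sym bα) rb)))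
  ... | inj₁ (inj₂ bβ) = trans (sym rb) (trans bβ rβ₀)

  numBlocks-zs< : numBlocks (lookup zs zero) ℕ.< numBlocks (lookup xs zero)
  numBlocks-zs< = numBlocks-< (lookup xs zero) (lookup zs zero) (root-zs⇒root zero) β rβ₀ β-nonroot-zs

-- A description of the order

-- These conditions are necessary for xs ≤ ys (≤P⇒≼) and, by the greedy construction
-- below, sufficient. Every merge joins the block of α with a block whose minimum β
-- is a layer-zero minimum larger than the minimum of α's block, whence keeps-nonbase-min.
record _≼_ (xs ys : Layers n (suc k)) : Set where
  field
    coarsens : ∀ m {i j} → rep xs m i ≡ rep xs m j → rep ys m i ≡ rep ys m j
    joins-across-base : ∀ m {i j} → rep ys m i ≡ rep ys m j → rep xs zero i ≡ rep xs zero j →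
                        rep xs m i ≡ rep xs m j
    keeps-nonbase-min : ∀ m i → rep xs zero (rep xs m i) ≢ rep xs m i → rep ys m i ≡ rep xs m i

≼-refl : (ys : Layers n (suc k)) → ys ≼ ys
≼-refl ys = record
  { coarsens = λ _ ij → ij
  ; joins-across-base = λ _ ij _ → ij
  ; keeps-nonbase-min = λ _ _ _ → refl
  }

mergeAt-≼ : (xs : Layers n (suc k)) (l : Fin (suc k)) (α β : Fin n) (wp : WP xs) (adm : Admissible xs l α β)
            (ys : Layers n (suc k)) → mergeAt xs l α β ≼ ys → xs ≼ ys
mergeAt-≼ xs l α β wp adm ys zs≼ys = record
  { coarsens = λ m ij → coarsens m (rep-zs-preserves m ij)
  ; joins-across-base = joins
  ; keeps-nonbase-min = keeps
  }
  where
  open AdmissibleMerge xs l α β wp adm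
  open _≼_ zs≼ys
  joins : ∀ m {i j} → rep ys m i ≡ rep ys m j → rep xs zero i ≡ rep xs zero j → rep xs m i ≡ rep xs m j
  joins m {i} {j} yij xij with joins-across-base m yij (rep-zs-preserves zero xij) | toℕ m ℕ.≤? toℕ l
  ... | zij | no m≰l = trans (sym (rep-zs-> m (ℕP.≰⇒> m≰l) i)) (trans zij (rep-zs-> m (ℕP.≰⇒> m≰l) j))
  ... | zij | yes m≤l with mergeBlocks-reflects (lookup xs m) α β
                             (trans (sym (rep-zs-≤ m m≤l i)) (trans zij (rep-zs-≤ m m≤l j)))
  ...   | inj₁ xij′ = xij′
  ...   | inj₂ (inj₁ iα , inj₁ jα) = trans iα (sym jα)
  ...   | inj₂ (inj₂ iβ , inj₂ jβ) = trans iβ (sym jβ)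
  ...   | inj₂ (inj₁ iα , inj₂ jβ) =
    ⊥-elim (α≁β (trans (sym (sameBlock-base m iα)) (trans xij (sameBlock-base m jβ))))
  ...   | inj₂ (inj₂ iβ , inj₁ jα) =
    ⊥-elim (α≁β (trans (sym (sameBlock-base m jα)) (trans (sym xij) (sameBlock-base m iβ))))
  keeps : ∀ m i → rep xs zero (rep xs m i) ≢ rep xs m i → rep ys m i ≡ rep xs m i
  keeps m i nonbase = trans (keeps-nonbase-min m i (subst (λ c → rep zs zero c ≢ c) (sym zmi)
                                                      (nonroot⇒nonroot-zs zero (rep xs m i) nonbase))) zmi
    where
    zmi : rep zs m i ≡ rep xs m i
    zmi with inJoin? (lookup xs m) α β i | toℕ m ℕ.≤? toℕ l
    ... | _ | no m≰l = rep-zs-> m (ℕP.≰⇒> m≰l) i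
    ... | inj₂ (¬iα , ¬iβ) | yes _ = rep-zs-∉ m i ¬iα ¬iβ
    ... | inj₁ (inj₁ iα) | yes m≤l = trans (rep-zs-∈ m m≤l i (inj₁ iα)) (sym iα)
    ... | inj₁ (inj₂ iβ) | yes _ = ⊥-elim (nonbase (trans (cong (rep xs zero) (trans iβ (rβ m)))
                                                    (trans rβ₀ (sym (trans iβ (rβ m))))))

≤P⇒≼ : {xs ys : Layers n (suc k)} → part xs ≤P part ys → xs ≼ ys
≤P⇒≼ {ys = ys} ε = ≼-refl ys
≤P⇒≼ ((_ , mergeStep xs l α β wp adm) ◅ rest) = mergeAt-≼ xs l α β wp adm _ (≤P⇒≼ rest)
≤P⇒≼ ((_ , topStep _ _ _) ◅ rest) with top≤P⇒≡top rest
... | ()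

-- Greedy rising chains

Toward : Layers n (suc k) → Layers n (suc k) → Label n (suc k) → Set
Toward xs ys (lab l a b) = Admissible xs l a b × (rep ys l a ≡ rep ys l b)

module LeastTowardStep (xs ys : Layers n (suc k)) (l : Fin (suc k)) (α β : Fin n)
                       (wp : WP xs) (wpy : WP ys) (adm : Admissible xs l α β) (xs≼ys : xs ≼ ys)
                       (joined : rep ys l α ≡ rep ys l β)
                       (least : ∀ t → Toward xs ys t → lab l α β ≤L t) where

  open AdmissibleMerge xs l α β wp adm
  open _≼_ xs≼ys
  private
    module Y = WeightedPartition ys wpy
    X Y Z : Fin (suc k) → Fin n → Fin n
    X = rep xs
    Y = rep ys
    Z = rep zs

  joined-below : ∀ m → m ≤ᶠ l → Y m α ≡ Y m β
  joined-below m m≤l = Y.sameBlock-down m l m≤l joined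

  InJoin⇒Y≡ : ∀ m → m ≤ᶠ l → ∀ {i} → InJoin (lookup xs m) α β i → Y m i ≡ Y m α
  InJoin⇒Y≡ m m≤l (inj₁ iα) = coarsens m iα
  InJoin⇒Y≡ m m≤l (inj₂ iβ) = trans (coarsens m iβ) (sym (joined-below m m≤l))

  no-toward-above : ∀ m {a b} → l <ᶠ m → ¬ Toward xs ys (lab m a b)
  no-toward-above m l<m toward = ≤L⇒≯ (least _ toward) (inj₁ l<m)

  -- Such a join would offer a label toward ys in a layer above l, which is smaller than (α, β)_l.
  no-join-above-roots : ∀ m → l <ᶠ m → ∀ {a b} → X m a ≡ a → X m b ≡ b → a <ᶠ b →
                        X zero a ≢ X zero b → Y m a ≢ Y m b
  no-join-above-roots m l<m {a} {b} ra rb a<b a≁b yab with X zero b ≟ b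
  ... | yes rb₀ = no-toward-above m l<m ((a<b , a≁b , rb₀ , ra) , yab)
  ... | no ¬rb₀ = ℕP.<⇒≱ a<b (subst (_≤ᶠ a) (trans yab yb) (Y.rep≤ m a))
    where
    yb : Y m b ≡ b
    yb = trans (keeps-nonbase-min m b (subst (λ c → X zero c ≢ c) (sym rb) ¬rb₀)) rb

  base-of-reps : ∀ m {i j} → X zero (X m i) ≡ X zero (X m j) → X zero i ≡ X zero j
  base-of-reps m {i} {j} e = trans (sym (sameBlock-base m (rep-idem m i))) (trans e (sameBlock-base m (rep-idem m j)))

  Y-of-reps : ∀ m {i j} → Y m i ≡ Y m j → Y m (X m i) ≡ Y m (X m j)
  Y-of-reps m {i} {j} yij = trans (coarsens m (rep-idem m i)) (trans yij (sym (coarsens m (rep-idem m j))))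

  no-join-above : ∀ m → l <ᶠ m → ∀ {i j} → Y m i ≡ Y m j → X zero i ≢ X zero j → ⊥
  no-join-above m l<m {i} {j} yij i≁j with FinP.<-cmp (X m i) (X m j)
  ... | tri< x _ _ = no-join-above-roots m l<m (rep-idem m i) (rep-idem m j) x
                       (i≁j ∘′ base-of-reps m) (Y-of-reps m yij)
  ... | tri> _ _ x = no-join-above-roots m l<m (rep-idem m j) (rep-idem m i) x
                       (i≁j ∘′ base-of-reps m ∘′ sym) (sym (Y-of-reps m yij))
  ... | tri≈ _ x _ = i≁j (base-of-reps m (cong (X zero) x))

  coarsens-zs : ∀ m {i j} → Z m i ≡ Z m j → Y m i ≡ Y m j
  coarsens-zs m {i} {j} zij with toℕ m ℕ.≤? toℕ l
  ... | no m≰l = coarsens m (trans (sym (rep-zs-> m (ℕP.≰⇒> m≰l) i)) (trans zij (rep-zs-> m (ℕP.≰⇒> m≰l) j)))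
  ... | yes m≤l
    with mergeBlocks-reflects (lookup xs m) α β (trans (sym (rep-zs-≤ m m≤l i)) (trans zij (rep-zs-≤ m m≤l j)))
  ...   | inj₁ xij = coarsens m xij
  ...   | inj₂ (i∈ , j∈) = trans (InJoin⇒Y≡ m m≤l i∈) (sym (InJoin⇒Y≡ m m≤l j∈))

  -- If i (on the α side) and j (on the β side) are joined in ys, the layer-m block of j
  -- is that of β: otherwise its minimum would have to be kept, which is incompatible
  -- with α's side having smaller layer-zero minima.
  β-side-block : ∀ m {i j} → Y m i ≡ Y m j → X zero i ≡ X zero α → X zero j ≡ X zero β → X m j ≡ X m β
  β-side-block m {i} {j} yij iα jβ with X zero (X m j) ≟ X m j
  ... | yes rb = trans (trans (sym rb) xb≡β) (sym (rβ m))
    where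
    xb≡β : X zero (X m j) ≡ β
    xb≡β = trans (sameBlock-base m (rep-idem m j)) (trans jβ rβ₀)
  ... | no ¬rb with X zero (X m i) ≟ X m i
  ...   | no ¬ra =
    ⊥-elim (α≁β (trans (sym iα) (trans (base-of-reps m (cong (X zero) (trans (sym ya≡a) ya≡b))) jβ)))
    where
    ya≡b : Y m (X m i) ≡ X m j
    ya≡b = trans (coarsens m (rep-idem m i)) (trans yij (keeps-nonbase-min m j ¬rb))
    ya≡a : Y m (X m i) ≡ X m i
    ya≡a = trans (keeps-nonbase-min m (X m i) (subst (λ c → X zero c ≢ c) (sym (rep-idem m i)) ¬ra)) (rep-idem m i)
  ...   | yes ra = ⊥-elim (ℕP.<-irrefl refl (ℕP.<-≤-trans a<β (ℕP.≤-trans β≤b b≤a)))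
    where
    a b : Fin n
    a = X m i
    b = X m j
    a<β : a <ᶠ β
    a<β = subst (_<ᶠ β) (trans (sym iα) (trans (sym (sameBlock-base m (rep-idem m i))) ra)) (rep-α<β zero)
    β≤b : β ≤ᶠ b
    β≤b = subst (_≤ᶠ b) (trans (sameBlock-base m (rep-idem m j)) (trans jβ rβ₀)) (rep≤ zero b)
    b≤a : b ≤ᶠ a
    b≤a = subst (_≤ᶠ a) (trans (coarsens m (rep-idem m i)) (trans yij (keeps-nonbase-min m j ¬rb))) (Y.rep≤ m a)

  joined-across : ∀ m {i j} → Y m i ≡ Y m j → X zero i ≡ X zero α → X zero j ≡ X zero β → Z m i ≡ Z m j
  joined-across m {i} {j} yij iα jβ with toℕ m ℕ.≤? toℕ l
  ... | no m≰l = ⊥-elim (no-join-above m (ℕP.≰⇒> m≰l) yij (λ e → α≁β (trans (sym iα) (trans e jβ))))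
  ... | yes m≤l = trans (rep-zs-∈ m m≤l i (inj₁ xiα)) (sym (rep-zs-∈ m m≤l j (inj₂ xjβ)))
    where
    xjβ : X m j ≡ X m β
    xjβ = β-side-block m yij iα jβ
    xiα : X m i ≡ X m α
    xiα = joins-across-base m (trans yij (trans (coarsens m xjβ) (sym (joined-below m m≤l)))) iα

  joins-across-base-zs : ∀ m {i j} → Y m i ≡ Y m j → Z zero i ≡ Z zero j → Z m i ≡ Z m j
  joins-across-base-zs m {i} {j} yij zij
    with mergeBlocks-reflects (lookup xs zero) α β
           (trans (sym (rep-zs-≤ zero z≤n i)) (trans zij (rep-zs-≤ zero z≤n j)))
  ... | inj₁ xij = rep-zs-preserves m (joins-across-base m yij xij)
  ... | inj₂ (inj₁ iα , inj₁ jα) = rep-zs-preserves m (joins-across-base m yij (trans iα (sym jα)))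
  ... | inj₂ (inj₂ iβ , inj₂ jβ) = rep-zs-preserves m (joins-across-base m yij (trans iβ (sym jβ)))
  ... | inj₂ (inj₁ iα , inj₂ jβ) = joined-across m yij iα jβ
  ... | inj₂ (inj₂ iβ , inj₁ jα) = sym (joined-across m (sym yij) jα iβ)

  Yβ-above : ∀ m → l <ᶠ m → Y m β ≡ β
  Yβ-above m l<m with Y m β ≟ β
  ... | yes yβ = yβ
  ... | no ¬yβ = ⊥-elim (no-toward-above m l<m ((c<β , c≁β , rβ₀ , Xc) , Y.rep-idem m β))
    where
    c : Fin n
    c = Y m β
    c<β : c <ᶠ β
    c<β = ℕP.≤∧≢⇒< (Y.rep≤ m β) (¬yβ ∘′ FinP.toℕ-injective)
    Xc : X m c ≡ c
    Xc = FinP.≤-antisym (rep≤ m c)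
           (subst (_≤ᶠ X m c) (trans (coarsens m (rep-idem m c)) (Y.rep-idem m β)) (Y.rep≤ m (X m c)))
    c≁β : X zero c ≢ X zero β
    c≁β e = ¬yβ (trans (sym Xc) (trans (joins-across-base m (Y.rep-idem m β) e) (rβ m)))

  keeps-nonbase-min-above : ∀ m → l <ᶠ m → ∀ i → Z zero (Z m i) ≢ Z m i → Y m i ≡ Z m i
  keeps-nonbase-min-above m l<m i nonbase with X zero (X m i) ≟ X m i
  ... | no ¬rb = trans (keeps-nonbase-min m i ¬rb) (sym zmi)
    where
    zmi : Z m i ≡ X m i
    zmi = rep-zs-> m l<m i
  ... | yes rb = trans (trans (coarsens m xiβ) (Yβ-above m l<m)) (sym (trans zmi b≡β))
    where
    zmi : Z m i ≡ X m i
    zmi = rep-zs-> m l<m i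
    b≡β : X m i ≡ β
    b≡β = lost-root≡β (X m i) rb (subst (λ c → Z zero c ≢ c) zmi nonbase)
    xiβ : X m i ≡ X m β
    xiβ = trans b≡β (sym (rβ m))

  keeps-nonbase-min-below : ∀ m → m ≤ᶠ l → ∀ i → Z zero (Z m i) ≢ Z m i → Y m i ≡ Z m i
  keeps-nonbase-min-below m m≤l i nonbase with inJoin? (lookup xs m) α β i
  ... | inj₁ i∈ = trans (InJoin⇒Y≡ m m≤l i∈) (trans (keeps-nonbase-min m α ¬rα) (sym zmi))
    where
    zmi : Z m i ≡ X m α
    zmi = rep-zs-∈ m m≤l i i∈
    ¬rα : X zero (X m α) ≢ X m α
    ¬rα e = nonbase (subst (λ c → Z zero c ≡ c) (sym zmi)
      (trans (rep-zs-∈ zero z≤n (X m α) (inj₁ (sameBlock-base m (rep-idem m α))))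
             (trans (sym (sameBlock-base m (rep-idem m α))) e)))
  ... | inj₂ (¬iα , ¬iβ) with X zero (X m i) ≟ X m i
  ...   | no ¬rb = trans (keeps-nonbase-min m i ¬rb) (sym (rep-zs-∉ m i ¬iα ¬iβ))
  ...   | yes rb = ⊥-elim (¬iβ (trans (lost-root≡β (X m i) rb
                     (subst (λ c → Z zero c ≢ c) (rep-zs-∉ m i ¬iα ¬iβ) nonbase)) (sym (rβ m))))

  keeps-nonbase-min-zs : ∀ m i → Z zero (Z m i) ≢ Z m i → Y m i ≡ Z m i
  keeps-nonbase-min-zs m i with toℕ m ℕ.≤? toℕ l
  ... | yes m≤l = keeps-nonbase-min-below m m≤l i
  ... | no  m≰l = keeps-nonbase-min-above m (ℕP.≰⇒> m≰l) i

  zs≼ys : zs ≼ ys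
  zs≼ys = record
    { coarsens = coarsens-zs
    ; joins-across-base = joins-across-base-zs
    ; keeps-nonbase-min = keeps-nonbase-min-zs
    }

Least : (Label n k → Set) → Label n k → Set
Least P g = P g × (∀ t → P t → g ≤L t)

private
  allLabels : List (Label n k)
  allLabels {n} {k} = cartesianProductWith (λ l ab → lab l (proj₁ ab) (proj₂ ab)) (allFin k)
                                           (cartesianProduct (allFin n) (allFin n))

  ∈-allLabels : (t : Label n k) → t ∈ allLabels
  ∈-allLabels (lab l a b) = ∈-cartesianProductWith⁺ (λ l ab → lab l (proj₁ ab) (proj₂ ab)) (∈-allFin l)
                                                    (∈-cartesianProduct⁺ (∈-allFin a) (∈-allFin b))

module _ (P : Label n k → Set) (P? : ∀ t → Dec (P t)) where

  private
    leastIn : ∀ ts → (∀ t → t ∈ ts → ¬ P t) ⊎ Σ (Label n k) λ g → P g × (∀ t → t ∈ ts → P t → g ≤L t)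
    leastIn [] = inj₁ (λ _ ())
    leastIn (t ∷ ts) with P? t | leastIn ts
    ... | no ¬pt | inj₁ none = inj₁ λ { _ (here refl) → ¬pt ; u (there u∈) → none u u∈ }
    ... | no ¬pt | inj₂ (g , pg , g≤) =
      inj₂ (g , pg , λ { _ (here refl) pt → ⊥-elim (¬pt pt) ; u (there u∈) → g≤ u u∈ })
    ... | yes pt | inj₁ none =
      inj₂ (t , pt , λ { _ (here refl) _ → inj₂ refl ; u (there u∈) pu → ⊥-elim (none u u∈ pu) })
    ... | yes pt | inj₂ (g , pg , g≤) with ≤L-total t g
    ...   | inj₁ t≤g =
      inj₂ (t , pt , λ { _ (here refl) _ → inj₂ refl ; u (there u∈) pu → ≤L-trans t≤g (g≤ u u∈ pu) })
    ...   | inj₂ g<t = inj₂ (g , pg , λ { _ (here refl) _ → inj₁ g<t ; u (there u∈) pu → g≤ u u∈ pu })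

  least? : (∀ t → ¬ P t) ⊎ Σ (Label n k) (Least P)
  least? with leastIn allLabels
  ... | inj₁ none = inj₁ λ t → none t (∈-allLabels t)
  ... | inj₂ (g , pg , g≤) = inj₂ (g , pg , λ t → g≤ t (∈-allLabels t))

admissible? : (xs : Layers n (suc k)) (l : Fin (suc k)) (a b : Fin n) → Dec (Admissible xs l a b)
admissible? xs l a b =
  (a FinP.<? b) ×-dec ¬? (rep xs zero a ≟ rep xs zero b) ×-dec (rep xs zero b ≟ b) ×-dec (rep xs l a ≟ a)

toward? : (xs ys : Layers n (suc k)) (t : Label n (suc k)) → Dec (Toward xs ys t)
toward? xs ys (lab l a b) = admissible? xs l a b ×-dec (rep ys l a ≟ rep ys l b)

Layers-ext : {xs ys : Layers n k} → (∀ m i → rep xs m i ≡ rep ys m i) → xs ≡ ys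
Layers-ext {xs = xs} {ys} xs≗ys =
  trans (sym (tabulate∘lookup xs)) (trans (tabulate-cong layer≡) (tabulate∘lookup ys))
  where
  layer≡ : ∀ m → lookup xs m ≡ lookup ys m
  layer≡ m = trans (sym (tabulate∘lookup (lookup xs m)))
                   (trans (tabulate-cong (xs≗ys m)) (tabulate∘lookup (lookup ys m)))

module _ (xs ys : Layers n (suc k)) (wp : WP xs) (wpy : WP ys) (xs≼ys : xs ≼ ys)
         (none : ∀ t → ¬ Toward xs ys t) where

  open WeightedPartition xs wp
  open _≼_ xs≼ys
  private
    module Y = WeightedPartition ys wpy
    X Y : Fin (suc k) → Fin n → Fin n
    X = rep xs
    Y = rep ys

  -- A layer-zero block of ys that is not one of xs would offer the label (c, a) in layer zero.
  base-≡-of-no-toward : ∀ i → X zero i ≡ Y zero i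
  base-≡-of-no-toward i with X zero i ≟ Y zero i
  ... | yes xi≡yi = xi≡yi
  ... | no  xi≢yi = ⊥-elim (none (lab zero c a) ((c<a , c≁a , rep-idem zero i , Xc) , trans Yc (sym Ya)))
    where
    a c : Fin n
    a = X zero i
    c = Y zero i
    Ya : Y zero a ≡ c
    Ya = coarsens zero (rep-idem zero i)
    c<a : c <ᶠ a
    c<a = ℕP.≤∧≢⇒< (subst (_≤ᶠ a) Ya (Y.rep≤ zero a)) (λ e → xi≢yi (sym (FinP.toℕ-injective e)))
    Yc : Y zero c ≡ c
    Yc = Y.rep-idem zero i
    Xc : X zero c ≡ c
    Xc = FinP.≤-antisym (rep≤ zero c)
           (subst (_≤ᶠ X zero c) (trans (coarsens zero (rep-idem zero c)) Yc) (Y.rep≤ zero (X zero c)))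
    c≁a : X zero c ≢ X zero a
    c≁a e = xi≢yi (sym (trans (sym Xc) (trans e (rep-idem zero i))))

  ≡-of-no-toward : xs ≡ ys
  ≡-of-no-toward = Layers-ext λ m i → FinP.≤-antisym (X≤Y m i) (Y≤X m i)
    where
    X≤Y : ∀ m i → X m i ≤ᶠ Y m i
    X≤Y m i = subst (_≤ᶠ Y m i)
      (joins-across-base m (Y.rep-idem m i)
        (trans (base-≡-of-no-toward (Y m i))
          (trans (Y.sameBlock-base m (Y.rep-idem m i)) (sym (base-≡-of-no-toward i)))))
      (rep≤ m (Y m i))
    Y≤X : ∀ m i → Y m i ≤ᶠ X m i
    Y≤X m i = subst (_≤ᶠ X m i) (coarsens m (rep-idem m i)) (Y.rep≤ m (X m i))

FirstLabel : (Label n k → Set) → Chain n k → Set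
FirstLabel P [] = ⊤
FirstLabel P ((t , _) ∷ _) = P t

FirstLabel-map : {P Q : Label n k → Set} → (∀ {t} → P t → Q t) → (cs : Chain n k) →
                 FirstLabel P cs → FirstLabel Q cs
FirstLabel-map f [] tt = tt
FirstLabel-map f (_ ∷ _) pt = f pt

rising-∷ : (t : Label n k) (z : LElem n k) (cs : Chain n k) → Rising cs → FirstLabel (t ≤L_) cs →
           Rising ((t , z) ∷ cs)
rising-∷ t z [] _ _ = [-]
rising-∷ t z (_ ∷ _) r t≤t′ = t≤t′ ∷ r

RisingChain : LElem n k → LElem n k → (Label n k → Set) → Set
RisingChain {n} {k} x y P = Σ (Chain n k) λ cs → IsChain x cs y × Rising cs × FirstLabel P cs

rising-chain-to-part : (ys : Layers n (suc k)) → WP ys → (xs : Layers n (suc k)) → WP xs → xs ≼ ys →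
                       RisingChain (part xs) (part ys) (Toward xs ys)
rising-chain-to-part ys wpy xs = go (suc (numBlocks (lookup xs zero))) xs ℕP.≤-refl
  where
  go : ∀ fuel xs → numBlocks (lookup xs zero) ℕ.< fuel → WP xs → xs ≼ ys →
       RisingChain (part xs) (part ys) (Toward xs ys)
  go (suc fuel) xs blocks<fuel wp xs≼ys with least? (Toward xs ys) (toward? xs ys)
  ... | inj₁ none = [] , cong part (≡-of-no-toward xs ys wp wpy xs≼ys none) , [] , tt
  ... | inj₂ (t@(lab l α β) , (adm , joined) , least)
    with go fuel zs (ℕP.<-≤-trans numBlocks-zs< (ℕP.≤-pred blocks<fuel)) zs-WP
            (LeastTowardStep.zs≼ys xs ys l α β wp wpy adm xs≼ys joined least)
    where open AdmissibleMerge xs l α β wp adm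
  ...   | cs , zs⇝ys , rising , first =
    (t , part zs) ∷ cs , (mergeStep xs l α β wp adm , zs⇝ys) ,
    rising-∷ t (part zs) cs rising
      (FirstLabel-map (λ {t′} toward → least t′ (toward-zs⇒toward t′ toward)) cs first) ,
    (adm , joined)
    where
    open AdmissibleMerge xs l α β wp adm
    toward-zs⇒toward : ∀ t′ → Toward zs ys t′ → Toward xs ys t′
    toward-zs⇒toward (lab _ _ _) (adm′ , joined′) = admissible-zs⇒admissible adm′ , joined′

TowardTop : Layers (suc n) (suc k) → Label (suc n) (suc k) → Set
TowardTop {n} {k} xs (lab l a b) = (l ≡ fromℕ k) × (a ≡ zero) × Admissible xs l a b

towardTop? : (xs : Layers (suc n) (suc k)) (t : Label (suc n) (suc k)) → Dec (TowardTop xs t)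
towardTop? {n} {k} xs (lab l a b) = (l ≟ fromℕ k) ×-dec (a ≟ zero) ×-dec admissible? xs l a b

≤L-topLabel : (b : Fin (suc n)) → lab (fromℕ k) zero b ≤L topLabel n k
≤L-topLabel {n} b with toℕ b ℕ.<? toℕ (fromℕ n)
... | yes b<n = inj₁ (inj₂ (inj₂ (refl , refl , b<n)))
... | no  b≮n = inj₂ (cong (lab _ _) (FinP.toℕ-injective (ℕP.≤-antisym
                  (subst (toℕ b ℕ.≤_) (sym (FinP.toℕ-fromℕ n)) (ℕP.≤-pred (FinP.toℕ<n b))) (ℕP.≮⇒≥ b≮n))))

-- Without an admissible label (0, b)ₖ every b > 0 lies in the block of 0, so the rank is n.
no-towardTop⇒rank : (xs : Layers (suc n) (suc k)) → WP xs → (∀ t → ¬ TowardTop xs t) → rank xs ≡ n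
no-towardTop⇒rank {n} {k} xs wp none =
  cong (suc n ∸_) (numBlocks≡1 (lookup xs zero) (r0 zero) only0)
  where
  open WeightedPartition xs wp
  r0 : ∀ m → rep xs m zero ≡ zero
  r0 m = FinP.≤-antisym (rep≤ m zero) z≤n
  only0 : ∀ i → rep xs zero i ≡ i → i ≡ zero
  only0 i ri with i ≟ zero
  ... | yes i≡0 = i≡0
  ... | no  i≢0 = ⊥-elim (none (lab (fromℕ k) zero i)
                   (refl , refl , 0<i , (λ e → i≢0 (sym (trans (sym (r0 zero)) (trans e ri)))) , ri , r0 (fromℕ k)))
    where
    0<i : zero {n} <ᶠ i
    0<i = ℕP.n≢0⇒n>0 (i≢0 ∘′ FinP.toℕ-injective)

rising-chain-to-top : (xs : Layers (suc n) (suc k)) → WP xs →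
                      RisingChain (part xs) top (λ t → TowardTop xs t ⊎ (t ≡ topLabel n k))
rising-chain-to-top {n} {k} xs = go (suc (numBlocks (lookup xs zero))) xs ℕP.≤-refl
  where
  go : ∀ fuel xs → numBlocks (lookup xs zero) ℕ.< fuel → WP xs →
       RisingChain (part xs) top (λ t → TowardTop xs t ⊎ (t ≡ topLabel n k))
  go (suc fuel) xs blocks<fuel wp with least? (TowardTop xs) (towardTop? xs)
  ... | inj₁ none = (topLabel n k , top) ∷ [] , (topStep xs wp (no-towardTop⇒rank xs wp none) , refl) , [-] , inj₂ refl
  ... | inj₂ (t@(lab _ _ b) , (refl , refl , adm) , least)
    with go fuel zs (ℕP.<-≤-trans numBlocks-zs< (ℕP.≤-pred blocks<fuel)) zs-WP
    where open AdmissibleMerge xs (fromℕ k) zero b wp adm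
  ...   | cs , zs⇝top , rising , first =
    (t , part zs) ∷ cs , (mergeStep xs (fromℕ k) zero b wp adm , zs⇝top) ,
    rising-∷ t (part zs) cs rising (FirstLabel-map t≤ cs first) , inj₁ (refl , refl , adm)
    where
    open AdmissibleMerge xs (fromℕ k) zero b wp adm
    t≤ : ∀ {t′} → TowardTop zs t′ ⊎ (t′ ≡ topLabel n k) → t ≤L t′
    t≤ {lab _ _ _} (inj₁ (l≡ , a≡ , adm′)) = least _ (l≡ , a≡ , admissible-zs⇒admissible adm′)
    t≤ (inj₂ refl) = ≤L-topLabel b

rising-chain-exists : (x y : LElem (suc n) (suc k)) → ValidL x → ValidL y → x ≤P y →
                      Σ (Chain (suc n) (suc k)) λ cs → IsChain x cs y × Rising cs
rising-chain-exists top y _ _ top≤y with top≤P⇒≡top top≤y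
... | refl = [] , refl , []
rising-chain-exists (part xs) (part ys) wp wpy xs≤ys
  with rising-chain-to-part ys wpy xs wp (≤P⇒≼ xs≤ys)
... | cs , c , r , _ = cs , c , r
rising-chain-exists (part xs) top wp _ _ with rising-chain-to-top xs wp
... | cs , c , r , _ = cs , c , r

mainTheorem3 : (n k : ℕ) → 1 ≤ n → 1 ≤ k → IsELLabeling n k
mainTheorem3 (suc n) (suc k) _ _ x y vx vy x≤y with rising-chain-exists x y vx vy x≤y
... | cs , c , r =
  cs , c , r , (λ cs′ c′ r′ → rising-unique cs cs′ c r c′ r′) , rising⇒FirstStepMinimal cs c r
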